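{- $\{0,1,2,4,16\}\subseteq J_{p3}[16]$.
   Context: An $S(2,4,v)$ design is a pair $(\mathcal{V},\mathcal{B})$ with $|\mathcal{V}|=v$ and $\mathcal{B}$ a family of 4-subsets (blocks) of $\mathcal{V}$ such that each 2-subset of $\mathcal{V}$ lies in exactly one block. A parallel class is a set of blocks partitioning $\mathcal{V}$. $J_{p3}[v]$ (for $v\equiv 4\pmod{12}$) is the set of integers $k$ such that there exist three $S(2,4,v)$ designs on the same point set, all containing a common parallel class $P$, whose block sets mutually intersect in the same set of blocks ($\mathcal{B}_1\cap\mathcal{B}_2=\mathcal{B}_1\cap\mathcal{B}_3=\mathcal{B}_2\cap\mathcal{B}_3$), this common set consisting of $P$ together with exactly $k$ further blocks. -}

module Defs where

open import Data.Nat using (ℕ; zero; suc; _+_)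
open import Data.Bool using (Bool; true; false; _∧_; if_then_else_)
open import Data.Fin using (Fin)
open import Data.Vec using (lookup)
open import Data.Fin.Subset using (Subset; ∣_∣)
open import Data.List using (List; []; _∷_; length)
open import Data.List.Membership.Propositional using (_∈_)
open import Data.List.Relation.Unary.All using (All)
open import Data.List.Relation.Unary.Unique.Propositional using (Unique)
open import Data.Product using (Σ; _×_; ∃-syntax)
open import Data.Sum using (_⊎_)
open import Relation.Binary.PropositionalEquality using (_≡_; _≢_)
open import Relation.Nullary using (¬_)
open import Function.Bundles using (_⇔_)

-- Points are Fin v; a block is a subset of Fin v (Vec Bool v);
-- a block family is a list of blocks (repetitions are counted).

pairCount : {v : ℕ} → List (Subset v) → Fin v → Fin v → ℕ
pairCount []       x y = 0
pairCount (b ∷ bs) x y =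
  (if lookup b x ∧ lookup b y then 1 else 0) + pairCount bs x y

pointCount : {v : ℕ} → List (Subset v) → Fin v → ℕ
pointCount []       x = 0
pointCount (b ∷ bs) x = (if lookup b x then 1 else 0) + pointCount bs x

IsS24 : (v : ℕ) → List (Subset v) → Set
IsS24 v B =
  All (λ b → ∣ b ∣ ≡ 4) B ×
  ((x y : Fin v) → x ≢ y → pairCount B x y ≡ 1)

IsParallelClass : (v : ℕ) → List (Subset v) → List (Subset v) → Set
IsParallelClass v B P =
  All (λ b → b ∈ B) P × ((x : Fin v) → pointCount P x ≡ 1)

InJp3 : (v : ℕ) → ℕ → Set
InJp3 v k =
  Σ (List (Subset v)) λ B₁ →
  Σ (List (Subset v)) λ B₂ →
  Σ (List (Subset v)) λ B₃ →
  Σ (List (Subset v)) λ P →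
  Σ (List (Subset v)) λ K →
    IsS24 v B₁ × IsS24 v B₂ × IsS24 v B₃ ×
    IsParallelClass v B₁ P × IsParallelClass v B₂ P × IsParallelClass v B₃ P ×
    ((b : Subset v) → (b ∈ B₁ × b ∈ B₂) ⇔ (b ∈ P ⊎ b ∈ K)) ×
    ((b : Subset v) → (b ∈ B₁ × b ∈ B₃) ⇔ (b ∈ P ⊎ b ∈ K)) ×
    ((b : Subset v) → (b ∈ B₂ × b ∈ B₃) ⇔ (b ∈ P ⊎ b ∈ K)) ×
    Unique K ×
    All (λ b → ¬ (b ∈ P)) K ×
    length K ≡ k

-- Every S(2,4,16) design is a copy of the affine plane AG(2,4). The five
-- memberships are witnessed by explicit triples of such copies sharing the
-- parallel class P = {0,1,2,3}, {4,5,6,7}, {8,9,10,11}, {12,13,14,15};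
-- for k = 16 the three designs coincide.
module Submission where

open import Defs
open import Data.Nat using (ℕ; _≡ᵇ_)
open import Data.Nat.Properties using (_≟_)
open import Data.Bool using (_∨_)
import Data.Bool.Properties as Bool
open import Data.Fin using (Fin; toℕ)
import Data.Fin.Properties as Fin
open import Data.Fin.Subset using (Subset; ∣_∣)
open import Data.Vec using (tabulate)
open import Data.Vec.Properties using (≡-dec)
open import Data.List using (List; []; _∷_; _++_; length)
open import Data.List.Membership.Propositional using (_∈_)
open import Data.List.Membership.Propositional.Properties using (∈-++⁺ˡ; ∈-++⁺ʳ; ∈-++⁻)
import Data.List.Membership.DecPropositional as DecMembership
open import Data.List.Relation.Unary.All as All using (All; all?)
open import Data.List.Relation.Unary.Unique.Propositional using (Unique)
open import Data.List.Relation.Unary.Unique.DecPropositional using (unique?)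
open import Data.Product using (_×_; _,_)
open import Data.Sum using (_⊎_; inj₁; inj₂)
open import Relation.Binary.PropositionalEquality using (refl)
open import Relation.Binary.Definitions using (DecidableEquality)
open import Relation.Nullary using (¬_; Dec)
open import Relation.Nullary.Decidable using (True; toWitness; _×-dec_; _→-dec_; ¬?)
open import Function.Bundles using (_⇔_; mk⇔)

module _ {v : ℕ} where

  _≟ˢ_ : DecidableEquality (Subset v)
  _≟ˢ_ = ≡-dec Bool._≟_

  open DecMembership _≟ˢ_ using (_∈?_)

  ListsIntersectIn : (A B C : List (Subset v)) → Set
  ListsIntersectIn A B C = All (λ a → a ∈ B → a ∈ C) A × All (λ c → c ∈ A × c ∈ B) C

  listsIntersectIn? : (A B C : List (Subset v)) → Dec (ListsIntersectIn A B C)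
  listsIntersectIn? A B C =
    all? (λ a → a ∈? B →-dec a ∈? C) A ×-dec all? (λ c → c ∈? A ×-dec c ∈? B) C

  listsIntersectIn-++⇒⇔ : {A B : List (Subset v)} (P K : List (Subset v)) →
    ListsIntersectIn A B (P ++ K) → (b : Subset v) → (b ∈ A × b ∈ B) ⇔ (b ∈ P ⊎ b ∈ K)
  listsIntersectIn-++⇒⇔ P K (A∩B⊆P++K , P++K⊆A∩B) b = mk⇔
    (λ (b∈A , b∈B) → ∈-++⁻ P (All.lookup A∩B⊆P++K b∈A b∈B))
    λ { (inj₁ b∈P) → All.lookup P++K⊆A∩B (∈-++⁺ˡ b∈P)
      ; (inj₂ b∈K) → All.lookup P++K⊆A∩B (∈-++⁺ʳ P b∈K) }

  isS24? : (B : List (Subset v)) → Dec (IsS24 v B)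
  isS24? B = all? (λ b → ∣ b ∣ ≟ 4) B
    ×-dec Fin.all? (λ x → Fin.all? λ y → ¬? (x Fin.≟ y) →-dec pairCount B x y ≟ 1)

  isParallelClass? : (B P : List (Subset v)) → Dec (IsParallelClass v B P)
  isParallelClass? B P = all? (_∈? B) P ×-dec Fin.all? (λ x → pointCount P x ≟ 1)

  Jp3Certificate : (B₁ B₂ B₃ P K : List (Subset v)) → Set
  Jp3Certificate B₁ B₂ B₃ P K =
    IsS24 v B₁ × IsS24 v B₂ × IsS24 v B₃ ×
    IsParallelClass v B₁ P × IsParallelClass v B₂ P × IsParallelClass v B₃ P ×
    ListsIntersectIn B₁ B₂ (P ++ K) × ListsIntersectIn B₁ B₃ (P ++ K) ×
    ListsIntersectIn B₂ B₃ (P ++ K) ×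
    Unique K × All (λ b → ¬ b ∈ P) K

  jp3Certificate? : (B₁ B₂ B₃ P K : List (Subset v)) → Dec (Jp3Certificate B₁ B₂ B₃ P K)
  jp3Certificate? B₁ B₂ B₃ P K =
    isS24? B₁ ×-dec isS24? B₂ ×-dec isS24? B₃ ×-dec
    isParallelClass? B₁ P ×-dec isParallelClass? B₂ P ×-dec isParallelClass? B₃ P ×-dec
    listsIntersectIn? B₁ B₂ (P ++ K) ×-dec listsIntersectIn? B₁ B₃ (P ++ K) ×-dec
    listsIntersectIn? B₂ B₃ (P ++ K) ×-dec
    unique? _≟ˢ_ K ×-dec all? (λ b → ¬? (b ∈? P)) K

  jp3Certificate⇒InJp3 : {B₁ B₂ B₃ P K : List (Subset v)} →
    Jp3Certificate B₁ B₂ B₃ P K → InJp3 v (length K)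
  jp3Certificate⇒InJp3 {B₁} {B₂} {B₃} {P} {K}
    (s₁ , s₂ , s₃ , p₁ , p₂ , p₃ , i₁₂ , i₁₃ , i₂₃ , uniqueK , K∩P≡∅) =
    B₁ , B₂ , B₃ , P , K , s₁ , s₂ , s₃ , p₁ , p₂ , p₃ ,
    listsIntersectIn-++⇒⇔ P K i₁₂ , listsIntersectIn-++⇒⇔ P K i₁₃ ,
    listsIntersectIn-++⇒⇔ P K i₂₃ , uniqueK , K∩P≡∅ , refl

block : ℕ → ℕ → ℕ → ℕ → Subset 16
block a b c d = tabulate λ i → (toℕ i ≡ᵇ a) ∨ (toℕ i ≡ᵇ b) ∨ (toℕ i ≡ᵇ c) ∨ (toℕ i ≡ᵇ d)

P : List (Subset 16)
P = block 0 1 2 3 ∷ block 4 5 6 7 ∷ block 8 9 10 11 ∷ block 12 13 14 15 ∷ []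

inJp3-16 : (L₁ L₂ L₃ K : List (Subset 16)) →
  {True (jp3Certificate? (P ++ L₁) (P ++ L₂) (P ++ L₃) P K)} → InJp3 16 (length K)
inJp3-16 L₁ L₂ L₃ K {certified} = jp3Certificate⇒InJp3 (toWitness certified)

L₁ : List (Subset 16)
L₁ =
    block 0 4 8 12 ∷ block 0 5 10 15 ∷ block 0 6 11 13 ∷ block 0 7 9 14
  ∷ block 1 4 11 14 ∷ block 1 5 9 13 ∷ block 1 6 8 15 ∷ block 1 7 10 12
  ∷ block 2 4 9 15 ∷ block 2 5 11 12 ∷ block 2 6 10 14 ∷ block 2 7 8 13
  ∷ block 3 4 10 13 ∷ block 3 5 8 14 ∷ block 3 6 9 12 ∷ block 3 7 11 15 ∷ []

L₂⁰ L₃⁰ L₂¹ L₃¹ L₂² L₃² L₂⁴ L₃⁴ K¹ K² K⁴ : List (Subset 16)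
L₂⁰ =
    block 0 4 10 12 ∷ block 0 5 8 14 ∷ block 0 6 9 13 ∷ block 0 7 11 15
  ∷ block 1 4 8 15 ∷ block 1 5 10 13 ∷ block 1 6 11 14 ∷ block 1 7 9 12
  ∷ block 2 4 11 13 ∷ block 2 5 9 15 ∷ block 2 6 8 12 ∷ block 2 7 10 14
  ∷ block 3 4 9 14 ∷ block 3 5 11 12 ∷ block 3 6 10 15 ∷ block 3 7 8 13 ∷ []
L₃⁰ =
    block 0 4 10 15 ∷ block 0 5 8 13 ∷ block 0 6 9 14 ∷ block 0 7 11 12
  ∷ block 1 4 11 13 ∷ block 1 5 9 15 ∷ block 1 6 8 12 ∷ block 1 7 10 14
  ∷ block 2 4 8 14 ∷ block 2 5 10 12 ∷ block 2 6 11 15 ∷ block 2 7 9 13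
  ∷ block 3 4 9 12 ∷ block 3 5 11 14 ∷ block 3 6 10 13 ∷ block 3 7 8 15 ∷ []
L₂¹ =
    block 0 4 9 13 ∷ block 0 5 11 12 ∷ block 0 6 10 15 ∷ block 0 7 8 14
  ∷ block 1 4 11 15 ∷ block 1 5 9 14 ∷ block 1 6 8 13 ∷ block 1 7 10 12
  ∷ block 2 4 10 14 ∷ block 2 5 8 15 ∷ block 2 6 9 12 ∷ block 2 7 11 13
  ∷ block 3 4 8 12 ∷ block 3 5 10 13 ∷ block 3 6 11 14 ∷ block 3 7 9 15 ∷ []
L₃¹ =
    block 0 4 11 12 ∷ block 0 5 10 14 ∷ block 0 6 9 15 ∷ block 0 7 8 13
  ∷ block 1 4 9 13 ∷ block 1 5 8 15 ∷ block 1 6 11 14 ∷ block 1 7 10 12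
  ∷ block 2 4 8 14 ∷ block 2 5 9 12 ∷ block 2 6 10 13 ∷ block 2 7 11 15
  ∷ block 3 4 10 15 ∷ block 3 5 11 13 ∷ block 3 6 8 12 ∷ block 3 7 9 14 ∷ []
L₂² =
    block 0 4 10 12 ∷ block 0 5 9 14 ∷ block 0 6 11 13 ∷ block 0 7 8 15
  ∷ block 1 4 11 14 ∷ block 1 5 8 12 ∷ block 1 6 10 15 ∷ block 1 7 9 13
  ∷ block 2 4 8 13 ∷ block 2 5 11 15 ∷ block 2 6 9 12 ∷ block 2 7 10 14
  ∷ block 3 4 9 15 ∷ block 3 5 10 13 ∷ block 3 6 8 14 ∷ block 3 7 11 12 ∷ []
L₃² =
    block 0 4 10 15 ∷ block 0 5 8 14 ∷ block 0 6 11 13 ∷ block 0 7 9 12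
  ∷ block 1 4 11 14 ∷ block 1 5 9 15 ∷ block 1 6 10 12 ∷ block 1 7 8 13
  ∷ block 2 4 8 12 ∷ block 2 5 10 13 ∷ block 2 6 9 14 ∷ block 2 7 11 15
  ∷ block 3 4 9 13 ∷ block 3 5 11 12 ∷ block 3 6 8 15 ∷ block 3 7 10 14 ∷ []
L₂⁴ =
    block 0 4 8 12 ∷ block 0 5 9 15 ∷ block 0 6 10 14 ∷ block 0 7 11 13
  ∷ block 1 4 9 13 ∷ block 1 5 8 14 ∷ block 1 6 11 15 ∷ block 1 7 10 12
  ∷ block 2 4 10 15 ∷ block 2 5 11 12 ∷ block 2 6 8 13 ∷ block 2 7 9 14
  ∷ block 3 4 11 14 ∷ block 3 5 10 13 ∷ block 3 6 9 12 ∷ block 3 7 8 15 ∷ []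
L₃⁴ =
    block 0 4 8 12 ∷ block 0 5 9 14 ∷ block 0 6 10 13 ∷ block 0 7 11 15
  ∷ block 1 4 9 15 ∷ block 1 5 8 13 ∷ block 1 6 11 14 ∷ block 1 7 10 12
  ∷ block 2 4 10 14 ∷ block 2 5 11 12 ∷ block 2 6 8 15 ∷ block 2 7 9 13
  ∷ block 3 4 11 13 ∷ block 3 5 10 15 ∷ block 3 6 9 12 ∷ block 3 7 8 14 ∷ []
K¹ = block 1 7 10 12 ∷ []
K² = block 0 6 11 13 ∷ block 1 4 11 14 ∷ []
K⁴ = block 0 4 8 12 ∷ block 1 7 10 12 ∷ block 2 5 11 12 ∷ block 3 6 9 12 ∷ []

corollary4p6 : InJp3 16 0 × InJp3 16 1 × InJp3 16 2 × InJp3 16 4 × InJp3 16 16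
corollary4p6 =
  inJp3-16 L₁ L₂⁰ L₃⁰ [] ,
  inJp3-16 L₁ L₂¹ L₃¹ K¹ ,
  inJp3-16 L₁ L₂² L₃² K² ,
  inJp3-16 L₁ L₂⁴ L₃⁴ K⁴ ,
  inJp3-16 L₁ L₁ L₁ L₁
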